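{- Let $K\leq\mathrm{Aut}(Q_n)$, $\Pi:=(Q_n)_K$, and let $\ell$ be a positive integer. (i) If $d_K\geq 2\ell$, then $a_{\ell-1}=0$ in $\Pi$. (ii) If $d_K\geq 2\ell+1$, then $c_\ell=\ell$ in $\Pi$.
   Context: The $n$-cube $Q_n$ has vertex set $\mathbb{F}_2^n$, two vectors adjacent iff their Hamming distance is $1$; $\mathrm{Aut}(Q_n)=\mathbb{F}_2^n: S_n$. For $K\leq\mathrm{Aut}(Q_n)$, $d_K:=\min\{d_{Q_n}(x,x^k): x\in\mathbb{F}_2^n,\ 1\neq k\in K\}$ if $K\neq 1$ and $d_K:=\infty$ if $K=1$. The normal quotient $(Q_n)_K$ is the simple graph whose vertices are the $K$-orbits, distinct orbits adjacent iff some vertex of one is adjacent in $Q_n$ to some vertex of the other. For a graph $\Pi$ and vertices $u,v$ with $d_\Pi(u,v)=i$, $c_i(u,v):=|\Pi_{i-1}(u)\cap\Pi(v)|$ and $a_i(u,v):=|\Pi_i(u)\cap\Pi(v)|$, where $\Pi_j(u)$ is the set of vertices at distance $j$ from $u$ and $\Pi(v)$ is the neighbourhood of $v$; "$c_i=c$" (resp. "$a_i=a$") means $c_i(u,v)=c$ (resp. $a_i(u,v)=a$) for all pairs at distance $i$. -}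

module Defs where

open import Data.Nat using (ℕ; zero; suc; _+_; _∸_; _≤_; _<_)
open import Data.Bool using (Bool; true; false; _xor_; if_then_else_)
open import Data.Fin using (Fin)
import Data.Fin as Fin
open import Data.Fin.Permutation using (Permutation; _⟨$⟩ʳ_; _⟨$⟩ˡ_; _∘ₚ_; flip)
import Data.Fin.Permutation as Perm
open import Data.List using (List; length)
open import Data.List.Relation.Unary.All using (All)
open import Data.List.Relation.Unary.Any using (Any)
open import Data.List.Relation.Unary.AllPairs using (AllPairs)
open import Data.Product using (Σ; _×_; ∃)
open import Relation.Nullary using (¬_)
open import Relation.Binary.PropositionalEquality using (_≡_)

-- Generic (simple) graph notions, on a vertex type V whose "same vertex"
-- relation is _≈_ (used for quotient graphs, where vertices are orbits
-- given by representatives).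

module Graph {V : Set} (_≈_ : V → V → Set) (Adj : V → V → Set) where

  data Walk : ℕ → V → V → Set where
    here : ∀ {u v} → u ≈ v → Walk 0 u v
    step : ∀ {m u w v} → Adj u w → Walk m w v → Walk (suc m) u v

  Dist : V → V → ℕ → Set
  Dist u v i = Walk i u v × (∀ j → j < i → ¬ Walk j u v)

  Card : (V → Set) → ℕ → Set
  Card P c = Σ (List V) λ L →
    length L ≡ c × All P L × AllPairs (λ a b → ¬ a ≈ b) L
      × (∀ w → P w → Any (λ a → w ≈ a) L)

  C-const : ℕ → ℕ → Set
  C-const i c = ∀ u v → Dist u v i → Card (λ w → Dist u w (i ∸ 1) × Adj v w) c

  A-const : ℕ → ℕ → Set
  A-const i a = ∀ u v → Dist u v i → Card (λ w → Dist u w i × Adj v w) a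

Vtx : ℕ → Set
Vtx n = Fin n → Bool

_≗ᵥ_ : ∀ {n} → Vtx n → Vtx n → Set
x ≗ᵥ y = ∀ i → x i ≡ y i

hamming : ∀ n → Vtx n → Vtx n → ℕ
hamming zero x y = 0
hamming (suc n) x y =
  (if x Fin.zero xor y Fin.zero then 1 else 0)
    + hamming n (λ i → x (Fin.suc i)) (λ i → y (Fin.suc i))

QAdj : ∀ n → Vtx n → Vtx n → Set
QAdj n x y = hamming n x y ≡ 1

module Q (n : ℕ) = Graph (_≗ᵥ_ {n}) (QAdj n)

-- Aut(Q_n) = F_2^n : S_n, element (σ , t) acting by
--   x ↦ x^σ + t,   (x^σ)_i = x_{σ⁻¹ i}

record Aut (n : ℕ) : Set where
  constructor aut
  field
    perm  : Permutation n n
    shift : Vtx n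

open Aut public

act : ∀ {n} → Aut n → Vtx n → Vtx n
act (aut σ t) x i = x (σ ⟨$⟩ˡ i) xor t i

e : ∀ {n} → Aut n
e = aut Perm.id (λ _ → false)

-- product: k₁ · k₂ acts as "first k₁, then k₂"
_·_ : ∀ {n} → Aut n → Aut n → Aut n
aut σ₁ t₁ · aut σ₂ t₂ = aut (σ₁ ∘ₚ σ₂) (λ i → t₁ (σ₂ ⟨$⟩ˡ i) xor t₂ i)

_⁻¹ : ∀ {n} → Aut n → Aut n
aut σ t ⁻¹ = aut (flip σ) (λ j → t (σ ⟨$⟩ʳ j))

IsIdentity : ∀ {n} → Aut n → Set
IsIdentity (aut σ t) = (∀ i → σ ⟨$⟩ʳ i ≡ i) × (∀ i → t i ≡ false)

record IsSubgroup {n : ℕ} (K : Aut n → Set) : Set where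
  field
    has-e  : K e
    has-·  : ∀ {a b} → K a → K b → K (a · b)
    has-⁻¹ : ∀ {a} → K a → K (a ⁻¹)

-- d_K ≥ m  (vacuous when K = 1, as d_1 = ∞)
dK≥ : ∀ {n} → (Aut n → Set) → ℕ → Set
dK≥ {n} K m = ∀ k → K k → ¬ IsIdentity k →
  ∀ x d → Q.Dist n x (act k x) d → m ≤ d

-- The normal quotient Π = (Q_n)_K, vertices = K-orbits (by representatives)

SameOrbit : ∀ {n} → (Aut n → Set) → Vtx n → Vtx n → Set
SameOrbit K x y = Σ _ λ k → K k × (act k x ≗ᵥ y)

QuotAdj : ∀ {n} → (Aut n → Set) → Vtx n → Vtx n → Set
QuotAdj {n} K u v = ¬ SameOrbit K u v ×
  Σ (Vtx n) λ x → Σ (Vtx n) λ y → SameOrbit K u x × SameOrbit K v y × QAdj n x y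

module Quot {n : ℕ} (K : Aut n → Set) = Graph (SameOrbit K) (QuotAdj K)

-- Lifting along the quotient map turns a quotient walk into a cube walk whose end point is only
-- determined up to K, and two distinct vertices of one K-orbit are at Hamming distance at least
-- d_K. So as long as all the Hamming distances involved stay below d_K, a lifted walk that returns
-- to the orbit it started from returns to its very starting vertex. For (i) this makes an odd
-- closed walk u → v → w → u of length 2ℓ − 1 < d_K into an odd closed walk in the bipartite cube.
-- For (ii), if y ∈ v lies at Hamming distance ℓ from u, the orbits of the ℓ neighbours of y that
-- are closer to u are pairwise distinct (any two are within distance 2 < d_K) and are at distance
-- ℓ − 1 from u; and a neighbour orbit w of v at distance ℓ − 1 from u containing a vertex z ~ y
-- farther from u would yield, lifting w → u from z, a vertex of u's orbit within distance
-- (ℓ + 1) + (ℓ − 1) < d_K of u, hence u itself, contradicting d(u, z) = ℓ + 1.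
module Submission where

open import Defs
open import Data.Nat using (ℕ; zero; suc; _+_; _*_; _∸_; _<_; _≤_; _≟_; z≤n; s≤s)
open import Data.Nat.Properties
open import Data.Nat.Tactic.RingSolver using (solve-∀)
open import Data.Bool using (Bool; true; false; _xor_; not; if_then_else_)
open import Data.Bool.Properties
  using (xor-same; xor-identityʳ; xor-comm; xor-assoc; xor-inverseʳ; xor-annihilates-not; not-¬)
open import Data.Fin using (Fin; zero; suc)
import Data.Fin.Properties as Fin
open import Data.Fin.Permutation using (_⟨$⟩ʳ_; _⟨$⟩ˡ_; flip; inverseʳ; inverseˡ)
open import Data.Vec.Functional using (head; tail) renaming (_∷_ to _◂_)
import Data.Vec.Functional.Relation.Binary.Pointwise.Properties as Pointwise
open import Data.List using (List; []; _∷_; map; length)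
open import Data.List.Properties using (length-map)
open import Data.List.Relation.Unary.All as All using (All; []; _∷_)
import Data.List.Relation.Unary.All.Properties as All
open import Data.List.Relation.Unary.Any using (here; there)
import Data.List.Relation.Unary.AllPairs as AllPairs
import Data.List.Relation.Unary.AllPairs.Properties as AllPairs
open import Data.List.Relation.Unary.Unique.Propositional using (Unique)
import Data.List.Relation.Unary.Unique.Propositional.Properties as Unique
open import Data.List.Membership.Propositional using (_∈_; lose)
open import Data.List.Membership.Propositional.Properties using (∈-map⁺)
open import Data.Product using (Σ; _×_; _,_; proj₁)
open import Data.Sum using (_⊎_; inj₁; inj₂)
open import Data.Empty using (⊥; ⊥-elim)
open import Relation.Nullary using (¬_; yes; no; contradiction)
open import Relation.Binary.Structures using (IsEquivalence)
open import Relation.Binary.Definitions using (Symmetric; Transitive; _Respectsˡ_)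
open import Relation.Binary.PropositionalEquality
open import Algebra.Properties.CommutativeMonoid.Sum +-0-commutativeMonoid
  using (sum; sum-permute; sum-cong-≗)

private variable
  n : ℕ

xor≡false⇒≡ : ∀ {a b} → a xor b ≡ false → a ≡ b
xor≡false⇒≡ {false} {false} _ = refl
xor≡false⇒≡ {true}  {true}  _ = refl

xor≡true⇒≡not : ∀ {a b} → a xor b ≡ true → b ≡ not a
xor≡true⇒≡not {false} {true}  _ = refl
xor≡true⇒≡not {true}  {false} _ = refl

xor-cancelʳ : ∀ a b t → (a xor t) xor (b xor t) ≡ a xor b
xor-cancelʳ a b false = cong₂ _xor_ (xor-identityʳ a) (xor-identityʳ b)
xor-cancelʳ a b true  =
  trans (cong₂ _xor_ (xor-comm a true) (xor-comm b true)) (xor-annihilates-not a b)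

-- Hamming distance and the action of Aut(Q_n)

hamming-cong : ∀ {x x′ y y′ : Vtx n} → x ≗ᵥ x′ → y ≗ᵥ y′ → hamming n x y ≡ hamming n x′ y′
hamming-cong {zero}  p q = refl
hamming-cong {suc n} p q rewrite p zero | q zero =
  cong₂ _+_ refl (hamming-cong (λ i → p (suc i)) (λ i → q (suc i)))

hamming-self : (x : Vtx n) → hamming n x x ≡ 0
hamming-self {zero}  x = refl
hamming-self {suc n} x rewrite xor-same (x zero) = hamming-self (tail x)

hamming-sym : (x y : Vtx n) → hamming n x y ≡ hamming n y x
hamming-sym {zero}  x y = refl
hamming-sym {suc n} x y rewrite xor-comm (x zero) (y zero) =
  cong₂ _+_ refl (hamming-sym (tail x) (tail y))

hamming≡0⇒≗ᵥ : (x y : Vtx n) → hamming n x y ≡ 0 → x ≗ᵥ y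
hamming≡0⇒≗ᵥ {suc n} x y h i with x zero xor y zero in x₀⊕y₀
hamming≡0⇒≗ᵥ {suc n} x y h zero    | false = xor≡false⇒≡ x₀⊕y₀
hamming≡0⇒≗ᵥ {suc n} x y h (suc i) | false = hamming≡0⇒≗ᵥ (tail x) (tail y) h i

≗ᵥ⇒hamming≡0 : {x y : Vtx n} → x ≗ᵥ y → hamming n x y ≡ 0
≗ᵥ⇒hamming≡0 {x = x} p = trans (hamming-cong (λ _ → refl) (λ i → sym (p i))) (hamming-self x)

hamming-sum : (x y : Vtx n) → hamming n x y ≡ sum (λ i → if x i xor y i then 1 else 0)
hamming-sum {zero}  x y = refl
hamming-sum {suc n} x y = cong₂ _+_ refl (hamming-sum (tail x) (tail y))

act-cong : (k : Aut n) {x y : Vtx n} → x ≗ᵥ y → act k x ≗ᵥ act k y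
act-cong (aut σ t) p i = cong (_xor t i) (p (σ ⟨$⟩ˡ i))

act-identity : (k : Aut n) → IsIdentity k → (x : Vtx n) → act k x ≗ᵥ x
act-identity (aut σ t) (σ≗id , t≗0) x i rewrite t≗0 i | xor-identityʳ (x (σ ⟨$⟩ˡ i)) =
  cong x (trans (sym (σ≗id (σ ⟨$⟩ˡ i))) (inverseʳ σ))

act-e : (x : Vtx n) → act e x ≗ᵥ x
act-e = act-identity e ((λ _ → refl) , (λ _ → refl))

act-· : (k l : Aut n) (x : Vtx n) → act (k · l) x ≗ᵥ act l (act k x)
act-· (aut σ s) (aut τ t) x i = sym (xor-assoc (x (σ ⟨$⟩ˡ (τ ⟨$⟩ˡ i))) (s (τ ⟨$⟩ˡ i)) (t i))

act-⁻¹ : (k : Aut n) (x : Vtx n) → act (k ⁻¹) (act k x) ≗ᵥ x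
act-⁻¹ (aut σ t) x i = begin
  (xᵢ xor tᵢ) xor tᵢ  ≡⟨ xor-cancelʳ xᵢ false tᵢ ⟩
  xᵢ xor false        ≡⟨ xor-identityʳ xᵢ ⟩
  xᵢ                  ≡⟨ cong x (inverseˡ σ) ⟩
  x i                 ∎
  where open ≡-Reasoning
        xᵢ = x (σ ⟨$⟩ˡ (σ ⟨$⟩ʳ i))
        tᵢ = t (σ ⟨$⟩ʳ i)

hamming-act : (k : Aut n) (x y : Vtx n) → hamming n (act k x) (act k y) ≡ hamming n x y
hamming-act {n} k@(aut σ t) x y = begin
  hamming n (act k x) (act k y)
    ≡⟨ hamming-sum (act k x) (act k y) ⟩
  sum (λ i → indicator ((x (σ ⟨$⟩ˡ i) xor t i) xor (y (σ ⟨$⟩ˡ i) xor t i)))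
    ≡⟨ sum-cong-≗ (λ i → cong indicator (xor-cancelʳ (x (σ ⟨$⟩ˡ i)) (y (σ ⟨$⟩ˡ i)) (t i))) ⟩
  sum (λ i → differ (σ ⟨$⟩ˡ i))
    ≡⟨ sum-permute differ (flip σ) ⟨
  sum differ
    ≡⟨ hamming-sum x y ⟨
  hamming n x y ∎
  where open ≡-Reasoning
        indicator : Bool → ℕ
        indicator b = if b then 1 else 0
        differ : Fin n → ℕ
        differ j = indicator (x j xor y j)

-- Neighbours in the cube

flipAt : Vtx n → Fin n → Vtx n
flipAt y zero    = not (head y) ◂ tail y
flipAt y (suc i) = head y ◂ flipAt (tail y) i

hamming-flipAt : (y : Vtx n) (i : Fin n) → hamming n y (flipAt y i) ≡ 1
hamming-flipAt y zero    rewrite xor-inverseʳ (y zero) = cong suc (hamming-self (tail y))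
hamming-flipAt y (suc i) rewrite xor-same (y zero)    = hamming-flipAt (tail y) i

flipAt-disagree : (x y : Vtx n) (i : Fin n) → x i xor y i ≡ true →
  hamming n x y ≡ suc (hamming n x (flipAt y i))
flipAt-disagree x y zero xᵢ⊕yᵢ with x zero | y zero
... | true  | false = refl
... | false | true  = refl
flipAt-disagree x y (suc i) xᵢ⊕yᵢ with x zero xor y zero
... | true  = cong suc (flipAt-disagree (tail x) (tail y) i xᵢ⊕yᵢ)
... | false = flipAt-disagree (tail x) (tail y) i xᵢ⊕yᵢ

flipAt-agree : (x y : Vtx n) (i : Fin n) → x i xor y i ≡ false →
  hamming n x (flipAt y i) ≡ suc (hamming n x y)
flipAt-agree x y zero xᵢ⊕yᵢ with x zero | y zero
... | true  | true  = refl
... | false | false = refl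
flipAt-agree x y (suc i) xᵢ⊕yᵢ with x zero xor y zero
... | true  = cong suc (flipAt-agree (tail x) (tail y) i xᵢ⊕yᵢ)
... | false = flipAt-agree (tail x) (tail y) i xᵢ⊕yᵢ

flipAt-injective : (y : Vtx n) {i j : Fin n} → flipAt y i ≗ᵥ flipAt y j → i ≡ j
flipAt-injective y {zero}  {zero}  p = refl
flipAt-injective y {zero}  {suc j} p = contradiction (sym (p zero)) (not-¬ refl)
flipAt-injective y {suc i} {zero}  p = contradiction (p zero) (not-¬ refl)
flipAt-injective y {suc i} {suc j} p = cong suc (flipAt-injective (tail y) (λ k → p (suc k)))

adjacent⇒flipAt : {x y : Vtx n} → QAdj n x y → Σ (Fin n) λ i → y ≗ᵥ flipAt x i
adjacent⇒flipAt {zero} ()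
adjacent⇒flipAt {suc n} {x} {y} x~y with x zero xor y zero in x₀⊕y₀
... | true  = zero , λ where
  zero    → xor≡true⇒≡not x₀⊕y₀
  (suc j) → sym (hamming≡0⇒≗ᵥ (tail x) (tail y) (suc-injective x~y) j)
... | false with adjacent⇒flipAt x~y
...   | i , y′≗ = suc i , λ where
  zero    → sym (xor≡false⇒≡ x₀⊕y₀)
  (suc j) → y′≗ j

hamming-flipAt-±1 : (z x : Vtx n) (i : Fin n) →
  hamming n x z ≡ suc (hamming n (flipAt x i) z) ⊎ hamming n (flipAt x i) z ≡ suc (hamming n x z)
hamming-flipAt-±1 z x i rewrite hamming-sym x z | hamming-sym (flipAt x i) z
  with z i xor x i in zᵢ⊕xᵢ
... | true  = inj₁ (flipAt-disagree z x i zᵢ⊕xᵢ)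
... | false = inj₂ (flipAt-agree z x i zᵢ⊕xᵢ)

hamming-adjacent : (z : Vtx n) {x y : Vtx n} → QAdj n x y →
  hamming n x z ≡ suc (hamming n y z) ⊎ hamming n y z ≡ suc (hamming n x z)
hamming-adjacent z {x} {y} x~y with adjacent⇒flipAt x~y
... | i , y≗xᵢ = subst (λ h → hamming _ x z ≡ suc h ⊎ h ≡ suc (hamming _ x z))
                       (hamming-cong (λ j → sym (y≗xᵢ j)) (λ _ → refl))
                       (hamming-flipAt-±1 z x i)

adjacent⇒≉ : {x y : Vtx n} → QAdj n x y → ¬ x ≗ᵥ y
adjacent⇒≉ x~y x≗y = 0≢1+n (trans (sym (≗ᵥ⇒hamming≡0 x≗y)) x~y)

disagreements : Vtx n → Vtx n → List (Fin n)
disagreements {zero}  x y = []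
disagreements {suc n} x y with x zero xor y zero
... | true  = zero ∷ map suc (disagreements (tail x) (tail y))
... | false = map suc (disagreements (tail x) (tail y))

length-disagreements : (x y : Vtx n) → length (disagreements x y) ≡ hamming n x y
length-disagreements {zero}  x y = refl
length-disagreements {suc n} x y with x zero xor y zero
... | true  = cong suc (trans (length-map suc (disagreements (tail x) (tail y)))
                              (length-disagreements (tail x) (tail y)))
... | false = trans (length-map suc (disagreements (tail x) (tail y)))
                    (length-disagreements (tail x) (tail y))

disagreements-sound : (x y : Vtx n) → All (λ i → x i xor y i ≡ true) (disagreements x y)
disagreements-sound {zero}  x y = []
disagreements-sound {suc n} x y with x zero xor y zero in x₀⊕y₀
... | true  = x₀⊕y₀ ∷ All.map⁺ (disagreements-sound (tail x) (tail y))
... | false = All.map⁺ (disagreements-sound (tail x) (tail y))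

∈-disagreements : (x y : Vtx n) {i : Fin n} → x i xor y i ≡ true → i ∈ disagreements x y
∈-disagreements {suc n} x y {zero} x₀⊕y₀ rewrite x₀⊕y₀ = here refl
∈-disagreements {suc n} x y {suc i} xᵢ⊕yᵢ with x zero xor y zero
... | true  = there (∈-map⁺ suc (∈-disagreements (tail x) (tail y) xᵢ⊕yᵢ))
... | false = ∈-map⁺ suc (∈-disagreements (tail x) (tail y) xᵢ⊕yᵢ)

disagreements-unique : (x y : Vtx n) → Unique (disagreements x y)
disagreements-unique {zero}  x y = AllPairs.[]
disagreements-unique {suc n} x y with x zero xor y zero
... | true  = All.map⁺ (All.universal (λ _ ()) _) AllPairs.∷ rest
  where rest = Unique.map⁺ Fin.suc-injective (disagreements-unique (tail x) (tail y))
... | false = Unique.map⁺ Fin.suc-injective (disagreements-unique (tail x) (tail y))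

-- Walks

module WalkProperties {V : Set} {_≈_ Adj : V → V → Set}
  (≈-isEquivalence : IsEquivalence _≈_)
  (adj-respˡ : Adj Respectsˡ _≈_) (adj-sym : Symmetric Adj) where

  open Graph _≈_ Adj
  open IsEquivalence ≈-isEquivalence
    renaming (refl to ≈-refl; sym to ≈-sym; trans to ≈-trans)

  walk-respˡ : ∀ {m u u′ v} → u′ ≈ u → Walk m u v → Walk m u′ v
  walk-respˡ p (here q)   = here (≈-trans p q)
  walk-respˡ p (step a w) = step (adj-respˡ (≈-sym p) a) w

  walk-respʳ : ∀ {m u v v′} → Walk m u v → v ≈ v′ → Walk m u v′
  walk-respʳ (here q)   p = here (≈-trans q p)
  walk-respʳ (step a w) p = step a (walk-respʳ w p)

  infixr 5 _++_
  _++_ : ∀ {j k u v w} → Walk j u v → Walk k v w → Walk (j + k) u w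
  here p   ++ w′ = walk-respˡ p w′
  step a w ++ w′ = step a (w ++ w′)

  snoc : ∀ {m u v w} → Walk m u v → Adj v w → Walk (suc m) u w
  snoc (here p)   a′ = step (adj-respˡ (≈-sym p) a′) (here ≈-refl)
  snoc (step a w) a′ = step a (snoc w a′)

  reverse : ∀ {m u v} → Walk m u v → Walk m v u
  reverse (here p)   = here (≈-sym p)
  reverse (step a w) = snoc (reverse w) (adj-sym a)

≗ᵥ-isEquivalence : IsEquivalence (_≗ᵥ_ {n})
≗ᵥ-isEquivalence {n} = Pointwise.isEquivalence isEquivalence n

qAdj-respˡ : QAdj n Respectsˡ _≗ᵥ_
qAdj-respˡ x≗x′ x~y = trans (hamming-cong (λ i → sym (x≗x′ i)) (λ _ → refl)) x~y

qAdj-sym : Symmetric (QAdj n)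
qAdj-sym {x = x} {y} x~y = trans (hamming-sym y x) x~y

module CubeWalk {n : ℕ} = WalkProperties (≗ᵥ-isEquivalence {n}) (qAdj-respˡ {n}) (qAdj-sym {n})

cons-walk : ∀ {m} {x y : Vtx (suc n)} → head x ≡ head y →
  Q.Walk n m (tail x) (tail y) → Q.Walk (suc n) m x y
cons-walk x₀≡y₀ (Q.here p) = Q.here λ where
  zero    → x₀≡y₀
  (suc i) → p i
cons-walk {n} {x = x} x₀≡y₀ (Q.step {w = w} a rest) =
  Q.step {w = head x ◂ w} x~x₀w (cons-walk x₀≡y₀ rest)
  where x~x₀w : hamming (suc n) x (head x ◂ w) ≡ 1
        x~x₀w rewrite xor-same (x zero) = a

geodesic : (x y : Vtx n) → Q.Walk n (hamming n x y) x y
geodesic {zero}  x y = Q.here λ ()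
geodesic {suc n} x y with x zero xor y zero in x₀⊕y₀
... | false = cons-walk (xor≡false⇒≡ x₀⊕y₀) (geodesic (tail x) (tail y))
... | true  = Q.step {w = head y ◂ tail x} x~y₀x′ (cons-walk refl (geodesic (tail x) (tail y)))
  where x~y₀x′ : hamming (suc n) x (head y ◂ tail x) ≡ 1
        x~y₀x′ rewrite x₀⊕y₀ = cong suc (hamming-self (tail x))

walk-parity : ∀ {j} {x y : Vtx n} → Q.Walk n j x y → Σ ℕ λ q → j ≡ hamming n x y + 2 * q
walk-parity (Q.here x≗y) = 0 , sym (trans (+-identityʳ _) (≗ᵥ⇒hamming≡0 x≗y))
walk-parity {x = x} {y} (Q.step {w = c} x~c rest) with walk-parity rest | hamming-adjacent y x~c
... | q , m≡ | inj₁ closer  = q , trans (cong suc m≡) (cong (_+ 2 * q) (sym closer))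
... | q , m≡ | inj₂ farther = suc q , (begin
  suc _                              ≡⟨ cong suc m≡ ⟩
  suc (hamming _ c y + 2 * q)        ≡⟨ cong (λ h → suc (h + 2 * q)) farther ⟩
  suc (suc (hamming _ x y) + 2 * q)  ≡⟨ two-more (hamming _ x y) q ⟩
  hamming _ x y + 2 * suc q          ∎)
  where open ≡-Reasoning
        two-more : ∀ h q → suc (suc h + 2 * q) ≡ h + 2 * suc q
        two-more = solve-∀

hamming≤length : ∀ {j} {x y : Vtx n} → Q.Walk n j x y → hamming n x y ≤ j
hamming≤length w with walk-parity w
... | q , j≡ = subst (_ ≤_) (sym j≡) (m≤m+n _ _)

closed-walk-even : ∀ {j} {x : Vtx n} → Q.Walk n j x x → Σ ℕ λ q → j ≡ 2 * q
closed-walk-even {x = x} w with walk-parity w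
... | q , j≡ = q , trans j≡ (cong (_+ 2 * q) (hamming-self x))

hamming-triangle : (x y z : Vtx n) → hamming n x z ≤ hamming n x y + hamming n y z
hamming-triangle x y z = hamming≤length (geodesic x y CubeWalk.++ geodesic y z)

geodesic-Dist : (x y : Vtx n) → Q.Dist n x y (hamming n x y)
geodesic-Dist x y = geodesic x y , λ j j<h w → <⇒≱ j<h (hamming≤length w)

-- Orbits and the normal quotient

dK≥-weaken : {K : Aut n → Set} {d d′ : ℕ} → d′ ≤ d → dK≥ K d → dK≥ K d′
dK≥-weaken d′≤d dK k k∈K k≢1 x j dist = ≤-trans d′≤d (dK k k∈K k≢1 x j dist)

sameOrbit⇒≗ᵥ : {K : Aut n → Set} {d : ℕ} → dK≥ K d → {x y : Vtx n} →
  SameOrbit K x y → hamming n x y < d → x ≗ᵥ y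
sameOrbit⇒≗ᵥ {n} {d = d} dK {x} {y} (k , k∈K , kx≗y) x-y<d with hamming n x y ≟ 0
... | yes x-y≡0 = hamming≡0⇒≗ᵥ x y x-y≡0
... | no  x-y≢0 = contradiction (dK k k∈K k≢1 x _ (geodesic-Dist x (act k x)))
                               (<⇒≱ (subst (_< d) (sym moved) x-y<d))
  where moved : hamming n x (act k x) ≡ hamming n x y
        moved = hamming-cong (λ _ → refl) kx≗y
        k≢1 : ¬ IsIdentity k
        k≢1 k≡1 = x-y≢0 (trans (sym moved) (≗ᵥ⇒hamming≡0 (λ i → sym (act-identity k k≡1 x i))))

flipAt-orbits-distinct : {K : Aut n → Set} → dK≥ K 3 → (y : Vtx n) {i j : Fin n} →
  i ≢ j → ¬ SameOrbit K (flipAt y i) (flipAt y j)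
flipAt-orbits-distinct dK y {i} {j} i≢j yᵢ~yⱼ =
  i≢j (flipAt-injective y (sameOrbit⇒≗ᵥ dK yᵢ~yⱼ (s≤s yᵢ-yⱼ≤2)))
  where yᵢ-yⱼ≤2 = ≤-trans (hamming-triangle (flipAt y i) y (flipAt y j))
                   (≤-reflexive (cong₂ _+_ (trans (hamming-sym (flipAt y i) y) (hamming-flipAt y i))
                                           (hamming-flipAt y j)))

module Quotient {n : ℕ} {K : Aut n → Set} (K≤Aut : IsSubgroup K) where

  open IsSubgroup K≤Aut
  open Quot K

  ≗ᵥ⇒sameOrbit : {x y : Vtx n} → x ≗ᵥ y → SameOrbit K x y
  ≗ᵥ⇒sameOrbit {x} x≗y = e , has-e , λ i → trans (act-e x i) (x≗y i)

  sameOrbit-sym : Symmetric (SameOrbit K)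
  sameOrbit-sym {x} {y} (k , k∈K , kx≗y) = k ⁻¹ , has-⁻¹ k∈K , λ i →
    trans (act-cong (k ⁻¹) {y} {act k x} (λ j → sym (kx≗y j)) i) (act-⁻¹ k x i)

  sameOrbit-trans : Transitive (SameOrbit K)
  sameOrbit-trans {x} {y} (k , k∈K , kx≗y) (l , l∈K , ly≗z) = k · l , has-· k∈K l∈K , λ i →
    trans (act-· k l x i) (trans (act-cong l {act k x} {y} kx≗y i) (ly≗z i))

  sameOrbit-isEquivalence : IsEquivalence (SameOrbit K)
  sameOrbit-isEquivalence = record
    { refl  = λ {x} → ≗ᵥ⇒sameOrbit {x} (λ _ → refl)
    ; sym   = λ {x} {y} → sameOrbit-sym {x} {y}
    ; trans = λ {x} {y} {z} → sameOrbit-trans {x} {y} {z}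
    }

  -- SameOrbit K x y unfolds to a statement about act k x, from which Agda cannot infer x;
  -- hence the vertices are passed explicitly to the orbit lemmas below.
  module Orbit = IsEquivalence sameOrbit-isEquivalence

  quotAdj-sym : Symmetric (QuotAdj K)
  quotAdj-sym {u} {v} (u≁v , x , y , u~x , v~y , x~y) =
    (λ v~u → u≁v (Orbit.sym {v} {u} v~u)) , y , x , v~y , u~x , qAdj-sym {n} {x} {y} x~y

  quotAdj-respˡ : QuotAdj K Respectsˡ SameOrbit K
  quotAdj-respˡ {v} {u} {u′} u~u′ (u≁v , x , y , u~x , v~y , x~y) =
    (λ u′~v → u≁v (Orbit.trans {u} {u′} {v} u~u′ u′~v)) , x , y ,
    Orbit.trans {u′} {u} {x} (Orbit.sym {u} {u′} u~u′) u~x , v~y , x~y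

  open WalkProperties sameOrbit-isEquivalence
    (λ {v} {u} {u′} → quotAdj-respˡ {v} {u} {u′}) (λ {u} {v} → quotAdj-sym {u} {v})

  lift-adjacent : {v w y : Vtx n} → SameOrbit K v y → QuotAdj K v w →
    Σ (Vtx n) λ z → SameOrbit K w z × QAdj n y z
  lift-adjacent {v} {w} {y} v~y (_ , a , b , v~a , w~b , a~b)
    with Orbit.trans {a} {v} {y} (Orbit.sym {v} {a} v~a) v~y
  ... | g , g∈K , ga≗y = act g b , Orbit.trans {w} {b} {act g b} w~b (g , g∈K , λ _ → refl) , (begin
    hamming n y (act g b)          ≡⟨ hamming-cong (λ i → sym (ga≗y i)) (λ _ → refl) ⟩
    hamming n (act g a) (act g b)  ≡⟨ hamming-act g a b ⟩
    hamming n a b                  ≡⟨ a~b ⟩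
    1                              ∎)
    where open ≡-Reasoning

  lift : ∀ {j} {v w y : Vtx n} → Walk j v w → SameOrbit K v y →
    Σ (Vtx n) λ z → SameOrbit K w z × Q.Walk n j y z
  lift {v = v} {w} {y} (here v~w) v~y =
    y , Orbit.trans {w} {v} {y} (Orbit.sym {v} {w} v~w) v~y , Q.here (λ _ → refl)
  lift {v = v} {w} {y} (step {w = c} v~c rest) v~y with lift-adjacent {v} {c} {y} v~y v~c
  ... | z₁ , c~z₁ , y~z₁ with lift {v = c} {w} {z₁} rest c~z₁
  ...   | z , w~z , z₁→z = z , w~z , Q.step y~z₁ z₁→z

  cube-adjacent⇒quotAdj : dK≥ K 2 → {v y z : Vtx n} → SameOrbit K v y → QAdj n y z →
    QuotAdj K v z
  cube-adjacent⇒quotAdj dK {v} {y} {z} v~y y~z = v≁z , y , z , v~y , Orbit.refl {z} , y~z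
    where
    v≁z : ¬ SameOrbit K v z
    v≁z v~z = adjacent⇒≉ y~z (sameOrbit⇒≗ᵥ dK y~z′ (≤-reflexive (cong suc y~z)))
      where y~z′ = Orbit.trans {y} {v} {z} (Orbit.sym {v} {y} v~y) v~z

  project : dK≥ K 2 → ∀ {j} {x y : Vtx n} → Q.Walk n j x y → Walk j x y
  project dK (Q.here x≗y)             = here (≗ᵥ⇒sameOrbit x≗y)
  project dK {x = x} (Q.step {w = c} x~c rest) =
    step (cube-adjacent⇒quotAdj dK {x} {x} {c} (Orbit.refl {x}) x~c) (project dK rest)

  lift-closing : ∀ {d j} → dK≥ K d → {w u z : Vtx n} → Walk j w u → SameOrbit K w z →
    hamming n u z + j < d → Q.Walk n j z u
  lift-closing dK {w} {u} {z} w→u w~z bound with lift w→u w~z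
  ... | x , u~x , z→x = CubeWalk.walk-respʳ z→x (λ i → sym (u≗x i))
    where u≗x = sameOrbit⇒≗ᵥ dK u~x (≤-<-trans (≤-trans (hamming-triangle u z x)
                  (+-monoʳ-≤ (hamming n u z) (hamming≤length z→x))) bound)

  hamming-lift-Dist : dK≥ K 2 → ∀ {j} {u v y : Vtx n} → Dist u v j → SameOrbit K v y →
    Q.Walk n j u y → hamming n u y ≡ j
  hamming-lift-Dist dK {u = u} {v} {y} (_ , minimal) v~y u→y =
    ≤-antisym (hamming≤length u→y) (≮⇒≥ λ u-y<j → minimal _ u-y<j
      (walk-respʳ (project dK (geodesic u y)) (Orbit.sym {v} {y} v~y)))

  dK≥2ℓ⇒aℓ₋₁≡0 : ∀ m → dK≥ K (2 * suc m) → A-const m 0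
  dK≥2ℓ⇒aℓ₋₁≡0 m dK u v (u→v , _) =
    [] , refl , [] , AllPairs.[] , λ w (dist , v~w) → ⊥-elim (no-odd-closed-walk w dist v~w)
    where
    odd-length : ∀ m → suc (suc m + m) ≡ 2 * suc m
    odd-length = solve-∀
    short : hamming n u u + (suc m + m) < 2 * suc m
    short = subst (λ h → h + (suc m + m) < 2 * suc m) (sym (hamming-self u))
                  (≤-reflexive (odd-length m))
    no-odd-closed-walk : ∀ w → Dist u w m → QuotAdj K v w → ⊥
    no-odd-closed-walk w (u→w , _) v~w
      with closed-walk-even (lift-closing dK (snoc u→v v~w ++ reverse u→w) (Orbit.refl {u}) short)
    ... | q , odd≡even =
      even≢odd q m (trans (sym odd≡even) (cong (λ k → suc (m + k)) (sym (+-identityʳ m))))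

  flipAt-Dist : dK≥ K 2 → ∀ {m} {u v y : Vtx n} → Dist u v (suc m) → SameOrbit K v y →
    hamming n u y ≡ suc m → ∀ {i} → u i xor y i ≡ true → Dist u (flipAt y i) m
  flipAt-Dist dK {m} {u} {v} {y} (_ , minimal) v~y u-y {i} uᵢ⊕yᵢ =
    subst (λ j → Walk j u (flipAt y i)) u-yᵢ (project dK (geodesic u (flipAt y i))) , no-shorter
    where
    u-yᵢ : hamming n u (flipAt y i) ≡ m
    u-yᵢ = suc-injective (trans (sym (flipAt-disagree u y i uᵢ⊕yᵢ)) u-y)
    yᵢ~v : QuotAdj K (flipAt y i) v
    yᵢ~v = quotAdj-sym {v} {flipAt y i}
             (cube-adjacent⇒quotAdj dK {v} {y} {flipAt y i} v~y (hamming-flipAt y i))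
    no-shorter : ∀ j → j < m → ¬ Walk j u (flipAt y i)
    no-shorter j j<m u→yᵢ = minimal (suc j) (s≤s j<m) (snoc u→yᵢ yᵢ~v)

  neighbour-below⇒flipAt : ∀ {m} → dK≥ K (2 * suc m + 1) → {u v w y : Vtx n} →
    SameOrbit K v y → hamming n u y ≡ suc m → Dist u w m → QuotAdj K v w →
    Σ (Fin n) λ i → u i xor y i ≡ true × SameOrbit K w (flipAt y i)
  neighbour-below⇒flipAt {m} dK {u} {v} {w} {y} v~y u-y (u→w , _) v~w
    with lift-adjacent {v} {w} {y} v~y v~w
  ... | z , w~z , y~z with adjacent⇒flipAt y~z
  ...   | i , z≗yᵢ with u i xor y i in uᵢ⊕yᵢ
  ...     | true  = i , uᵢ⊕yᵢ , Orbit.trans {w} {z} {flipAt y i} w~z (≗ᵥ⇒sameOrbit z≗yᵢ)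
  ...     | false = ⊥-elim (1+n≰n (≤-trans (n≤1+n (suc m)) (subst (_≤ m) z-u (hamming≤length z→u))))
    where
    u-z : hamming n u z ≡ suc (suc m)
    u-z = trans (hamming-cong (λ _ → refl) z≗yᵢ) (trans (flipAt-agree u y i uᵢ⊕yᵢ) (cong suc u-y))
    z-u : hamming n z u ≡ suc (suc m)
    z-u = trans (hamming-sym z u) u-z
    length-bound : ∀ m → suc (suc (suc m) + m) ≡ 2 * suc m + 1
    length-bound = solve-∀
    z→u : Q.Walk n m z u
    z→u = lift-closing dK {w} {u} {z} (reverse u→w) w~z
            (subst (λ h → h + m < 2 * suc m + 1) (sym u-z) (≤-reflexive (length-bound m)))

  dK≥2ℓ+1⇒cℓ≡ℓ : ∀ m → dK≥ K (2 * suc m + 1) → C-const (suc m) (suc m)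
  dK≥2ℓ+1⇒cℓ≡ℓ m dK u v dist with lift {v = u} {v} {u} (proj₁ dist) (Orbit.refl {u})
  ... | y , v~y , u→y =
    map (flipAt y) (disagreements u y) ,
    trans (length-map (flipAt y) (disagreements u y)) (trans (length-disagreements u y) u-y) ,
    All.map⁺ (All.map flip-below (disagreements-sound u y)) ,
    AllPairs.map⁺ (AllPairs.map (flipAt-orbits-distinct dK₃ y) (disagreements-unique u y)) ,
    λ w (u-w , v~w) →
      let (i , uᵢ⊕yᵢ , w~yᵢ) = neighbour-below⇒flipAt dK {u} {v} {w} {y} v~y u-y u-w v~w
      in lose (∈-map⁺ (flipAt y) (∈-disagreements u y uᵢ⊕yᵢ)) w~yᵢ
    where
    dK₃ : dK≥ K 3
    dK₃ = dK≥-weaken (+-monoˡ-≤ 1 (*-monoʳ-≤ 2 (s≤s z≤n))) dK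
    dK₂ : dK≥ K 2
    dK₂ = dK≥-weaken (n≤1+n 2) dK₃
    u-y : hamming n u y ≡ suc m
    u-y = hamming-lift-Dist dK₂ dist v~y u→y
    flip-below : ∀ {i} → u i xor y i ≡ true → Dist u (flipAt y i) m × QuotAdj K v (flipAt y i)
    flip-below {i} uᵢ⊕yᵢ =
      flipAt-Dist dK₂ dist v~y u-y uᵢ⊕yᵢ ,
      cube-adjacent⇒quotAdj dK₂ {v} {y} {flipAt y i} v~y (hamming-flipAt y i)

lemma3p6 : (n : ℕ) (K : Aut n → Set) → IsSubgroup K → (ℓ : ℕ) → 0 < ℓ →
    (dK≥ K (2 * ℓ) → Quot.A-const K (ℓ ∸ 1) 0)
      × (dK≥ K (2 * ℓ + 1) → Quot.C-const K ℓ ℓ)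
lemma3p6 n K K≤Aut (suc m) _ = dK≥2ℓ⇒aℓ₋₁≡0 m , dK≥2ℓ+1⇒cℓ≡ℓ m
  where open Quotient K≤Aut
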